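{- Let $n\ge1$, let $\phi$ be an $n$-cube unique sink orientation, and let $\psi$ be a kaleidoscope for $\phi$. Let $F\subseteq[2n]$ and let $\psi'$ be the mirror image of $\psi$ along dimensions $F$, i.e. $\psi'(V)=\psi(V\oplus F)$ for all $V\subseteq[2n]$. Then $\psi'$ contains $\phi$, i.e. there is $V\subseteq\{n+1,\dots,2n\}$ such that $\psi'(U)_L=\phi(U_L)$ for all $U$ with $V\subseteq U\subseteq V\cup[n]$.
   Context: Notation: $[m]=\{1,\dots,m\}$, $\oplus$ is symmetric difference. An $m$-cube orientation is a directed graph on $2^{[m]}$ containing exactly one of the edges $(V,V\oplus\{i\})$, $(V\oplus\{i\},V)$ for each $V\subseteq[m]$, $i\in[m]$; it is identified with its outmap $V\mapsto\{i: (V,V\oplus\{i\})\text{ is an edge}\}$. It is a unique sink orientation (USO) if every face (subgraph induced by a set $\{X: A\subseteq X\subseteq B\}$) has exactly one sink. For $V\subseteq[2n]$ let $V_L=V\cap[n]$ and $V_H=\{i-n: i\in V\cap\{n+1,\dots,2n\}\}$. A $2n$-cube USO $\psi$ is a kaleidoscope for the $n$-cube USO $\phi$ if $\psi(V)_L=\phi(V_L\oplus V_H)$ for all $V\subseteq[2n]$. -}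

module Defs where

open import Data.Nat using (ℕ; _+_)
open import Data.Bool using (Bool; true; false; _xor_)
open import Data.Vec using (Vec; zipWith; take; drop; _++_; replicate)
open import Data.Fin.Subset using (Subset; _⊆_; _∩_; _─_; _∪_; ⊥; ⊤)
open import Data.Product using (∃; _×_)
open import Relation.Binary.PropositionalEquality using (_≡_)

-- Subsets of [m] are characteristic vectors (Subset m = Vec Bool m);
-- coordinate i (Fin m, 0-based) represents element i+1 of [m].

_⊕_ : ∀ {m} → Subset m → Subset m → Subset m
_⊕_ = zipWith _xor_

-- a cube orientation identified with its outmap
Outmap : ℕ → Set
Outmap m = Subset m → Subset m

InFace : ∀ {m} → Subset m → Subset m → Subset m → Set
InFace A B X = A ⊆ X × X ⊆ B

IsSinkOfFace : ∀ {m} → Outmap m → Subset m → Subset m → Subset m → Set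
IsSinkOfFace φ A B X = InFace A B X × (φ X ∩ (B ─ A) ≡ ⊥)

IsUSO : ∀ {m} → Outmap m → Set
IsUSO {m} φ = ∀ (A B : Subset m) → A ⊆ B →
  ∃ λ X → IsSinkOfFace φ A B X × (∀ Y → IsSinkOfFace φ A B Y → Y ≡ X)

low : ∀ {n} → Subset (n + n) → Subset n
low {n} V = take n V

high : ∀ {n} → Subset (n + n) → Subset n
high {n} V = drop n V

IsKaleidoscope : ∀ {n} → Outmap n → Outmap (n + n) → Set
IsKaleidoscope {n} φ ψ =
  IsUSO ψ × (∀ (V : Subset (n + n)) → low (ψ V) ≡ φ (low V ⊕ high V))

mirror : ∀ {m} → Subset m → Outmap m → Outmap m
mirror F ψ V = ψ (V ⊕ F)

lowPart : ∀ {n} → Subset (n + n)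
lowPart {n} = replicate n true ++ replicate n false

highPart : ∀ {n} → Subset (n + n)
highPart {n} = replicate n false ++ replicate n true

Contains : ∀ {n} → Outmap (n + n) → Outmap n → Set
Contains {n} ψ' φ = ∃ λ (V : Subset (n + n)) → V ⊆ highPart {n} ×
  (∀ (U : Subset (n + n)) → V ⊆ U → U ⊆ (V ∪ lowPart {n}) → low (ψ' U) ≡ φ (low U))

-- Take V with V_L = ∅ and V_H = F_L ⊕ F_H. Every U in the face [V, V ∪ [n]] has U_H = V_H,
-- so the kaleidoscope identity gives ψ'(U)_L = φ((U ⊕ F)_L ⊕ (U ⊕ F)_H)
-- = φ((U_L ⊕ F_L) ⊕ (F_L ⊕ F_H) ⊕ F_H) = φ(U_L).
module Submission where

open import Defs
open import Data.Nat using (ℕ; _≥_; _+_; zero; suc)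
open import Data.Bool using (_xor_)
open import Data.Bool.Properties using (xor-assoc; xor-identityʳ; xor-same)
open import Data.Fin.Subset using (Subset; _⊆_; _∪_; ⊥; ⊤)
open import Data.Fin.Subset.Properties using (drop-∷-⊆; out⊆; ⊆⊤; ⊆-antisym; ∪-identityʳ)
open import Data.Vec using ([]; _∷_; _++_)
open import Data.Vec.Properties
  using (zipWith-assoc; zipWith-identityʳ; zipWith-++; take-zipWith; drop-zipWith; take++drop≡id)
open import Data.Product using (_,_)
open import Relation.Binary.PropositionalEquality
open ≡-Reasoning

⊕-assoc : ∀ {m} (x y z : Subset m) → (x ⊕ y) ⊕ z ≡ x ⊕ (y ⊕ z)
⊕-assoc = zipWith-assoc xor-assoc

⊕-identityʳ : ∀ {m} (x : Subset m) → x ⊕ ⊥ ≡ x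
⊕-identityʳ = zipWith-identityʳ xor-identityʳ

⊕-self : ∀ {m} (x : Subset m) → x ⊕ x ≡ ⊥
⊕-self [] = refl
⊕-self (b ∷ x) = cong₂ _∷_ (xor-same b) (⊕-self x)

⊕-cancelʳ : ∀ {m} (x y : Subset m) → (x ⊕ y) ⊕ y ≡ x
⊕-cancelʳ x y = begin
  (x ⊕ y) ⊕ y  ≡⟨ ⊕-assoc x y y ⟩
  x ⊕ (y ⊕ y)  ≡⟨ cong (x ⊕_) (⊕-self y) ⟩
  x ⊕ ⊥        ≡⟨ ⊕-identityʳ x ⟩
  x            ∎

low-⊕ : ∀ {n} (U F : Subset (n + n)) → low {n} (U ⊕ F) ≡ low U ⊕ low F
low-⊕ {n} = take-zipWith _xor_

high-⊕ : ∀ {n} (U F : Subset (n + n)) → high {n} (U ⊕ F) ≡ high U ⊕ high F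
high-⊕ {n} = drop-zipWith _xor_

++-⊆-cancelˡ : ∀ {m k} (xs us : Subset m) {ys vs : Subset k} →
  xs ++ ys ⊆ us ++ vs → ys ⊆ vs
++-⊆-cancelˡ []       []       p = p
++-⊆-cancelˡ (_ ∷ xs) (_ ∷ us) p = ++-⊆-cancelˡ xs us (drop-∷-⊆ p)

⊥++-⊆-⊥++ : ∀ m {k} {ys vs : Subset k} → ys ⊆ vs → ⊥ {m} ++ ys ⊆ ⊥ {m} ++ vs
⊥++-⊆-⊥++ zero    p = p
⊥++-⊆-⊥++ (suc m) p = out⊆ (⊥++-⊆-⊥++ m p)

high-of-face : ∀ {n} (H : Subset n) (U : Subset (n + n)) →
  ⊥ ++ H ⊆ U → U ⊆ (⊥ ++ H) ∪ lowPart {n} → high {n} U ≡ H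
high-of-face {n} H U V⊆U U⊆V∪L = ⊆-antisym U_H⊆H H⊆U_H
  where
  U-split : U ≡ low {n} U ++ high U
  U-split = sym (take++drop≡id n U)

  V∪L-split : (⊥ ++ H) ∪ lowPart {n} ≡ (⊥ {n} ∪ ⊤) ++ (H ∪ ⊥)
  V∪L-split = zipWith-++ _ ⊥ H ⊤ ⊥

  H⊆U_H : H ⊆ high U
  H⊆U_H = ++-⊆-cancelˡ ⊥ (low U) (subst (⊥ ++ H ⊆_) U-split V⊆U)

  U_H⊆H : high U ⊆ H
  U_H⊆H = subst (high U ⊆_) (∪-identityʳ H)
    (++-⊆-cancelˡ (low U) (⊥ ∪ ⊤) (subst₂ _⊆_ U-split V∪L-split U⊆V∪L))

lemma4 : (n : ℕ) → n ≥ 1 → (φ : Outmap n) → IsUSO φ →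
    (ψ : Outmap (n + n)) → IsKaleidoscope φ ψ →
    (F : Subset (n + n)) → Contains (mirror F ψ) φ
lemma4 n _ φ _ ψ (_ , kaleidoscope) F = ⊥ ++ H , ⊥++-⊆-⊥++ n ⊆⊤ , face-agrees
  where
  H : Subset n
  H = low F ⊕ high F

  face-agrees : ∀ U → ⊥ ++ H ⊆ U → U ⊆ (⊥ ++ H) ∪ lowPart {n} →
    low (mirror F ψ U) ≡ φ (low U)
  face-agrees U V⊆U U⊆V∪L = begin
    low (ψ (U ⊕ F))
      ≡⟨ kaleidoscope (U ⊕ F) ⟩
    φ (low (U ⊕ F) ⊕ high (U ⊕ F))
      ≡⟨ cong φ (cong₂ _⊕_ (low-⊕ U F) (high-⊕ U F)) ⟩
    φ ((low U ⊕ low F) ⊕ (high U ⊕ high F))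
      ≡⟨ cong (λ X → φ ((low U ⊕ low F) ⊕ (X ⊕ high F))) (high-of-face H U V⊆U U⊆V∪L) ⟩
    φ ((low U ⊕ low F) ⊕ (H ⊕ high F))
      ≡⟨ cong (λ X → φ ((low U ⊕ low F) ⊕ X)) (⊕-cancelʳ (low F) (high F)) ⟩
    φ ((low U ⊕ low F) ⊕ low F)
      ≡⟨ cong φ (⊕-cancelʳ (low U) (low F)) ⟩
    φ (low U)
      ∎
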